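{- Let $(K,v)$ be a valued field of characteristic $p>0$. Then for every additive polynomial $f$ over $K$ (in any number of variables) the image of $f$ has the optimal approximation property if and only if $(K,v)$ is $K$-extremal with respect to every $p$-polynomial over $K$.
   Context: A polynomial $f\in K[X_1,\dots,X_n]$ is additive if $f(x+y)=f(x)+f(y)$ identically. A $p$-polynomial is a polynomial of the form $f+c$ with $f\in K[X_1,\dots,X_n]$ additive and $c\in K$. For $S\subseteq K$ and $h\in K[X_1,\dots,X_n]$, $(K,v)$ is $S$-extremal with respect to $h$ if the set $vh(S^n)\subseteq vK\cup\{\infty\}$ has a maximum. A subset $S\subseteq K$ has the optimal approximation property if for every $z\in K$ there is $y\in S$ with $v(z-y)=\max\{v(z-x)\mid x\in S\}$. -}

module Defs where

open import Level using (Level; _⊔_) renaming (suc to lsuc)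
open import Data.Nat as ℕ using (ℕ; zero; suc)
open import Data.Nat.Combinatorics using (_C_)
open import Data.Nat.Primality using (Prime)
open import Data.Fin using (Fin; toℕ) renaming (zero to fzero; suc to fsuc)
open import Data.Product using (Σ; ∃; _×_; _,_)
open import Data.Empty using (⊥)
open import Relation.Nullary using (¬_)
open import Relation.Binary.Structures using (IsTotalOrder)
open import Relation.Binary.PropositionalEquality using (_≡_)
open import Algebra.Bundles using (CommutativeRing; AbelianGroup)

record Field (c ℓ : Level) : Set (lsuc (c ⊔ ℓ)) where
  field
    commRing : CommutativeRing c ℓ
  open CommutativeRing commRing public
  field
    1≉0      : ¬ (1# ≈ 0#)
    inverse  : ∀ x → ¬ (x ≈ 0#) → ∃ λ y → x * y ≈ 1#

record OrderedAbelianGroup (g ℓ ℓ≤ : Level) : Set (lsuc (g ⊔ ℓ ⊔ ℓ≤)) where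
  field
    abGroup     : AbelianGroup g ℓ
  open AbelianGroup abGroup public renaming (_∙_ to _+_; ε to 0g)
  field
    _≤_         : Carrier → Carrier → Set ℓ≤
    isTotalOrder : IsTotalOrder _≈_ _≤_
    +-mono-≤    : ∀ a b c → a ≤ b → (a + c) ≤ (b + c)

data WithInfty {g} (G : Set g) : Set g where
  ι : G → WithInfty G
  ∞ : WithInfty G

module _ {g ℓ ℓ≤} (Γ : OrderedAbelianGroup g ℓ ℓ≤) where
  open OrderedAbelianGroup Γ

  data _≤∞_ : WithInfty Carrier → WithInfty Carrier → Set (g ⊔ ℓ≤) where
    ι≤ι : ∀ {a b} → a ≤ b → ι a ≤∞ ι b
    _≤∞ : ∀ x → x ≤∞ ∞

  data _≈∞_ : WithInfty Carrier → WithInfty Carrier → Set (g ⊔ ℓ) where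
    ι≈ι : ∀ {a b} → a ≈ b → ι a ≈∞ ι b
    ∞≈∞ : ∞ ≈∞ ∞

  _+∞_ : WithInfty Carrier → WithInfty Carrier → WithInfty Carrier
  ι a +∞ ι b = ι (a + b)
  ι a +∞ ∞   = ∞
  ∞   +∞ _   = ∞

  -- "min(x,y) ≤ z", i.e. x ≤ z or y ≤ z
  data MinLe (x y z : WithInfty Carrier) : Set (g ⊔ ℓ≤) where
    left  : x ≤∞ z → MinLe x y z
    right : y ≤∞ z → MinLe x y z

record ValuedField (c ℓ g ℓΓ ℓ≤ : Level) : Set (lsuc (c ⊔ ℓ ⊔ g ⊔ ℓΓ ⊔ ℓ≤)) where
  field
    K  : Field c ℓ
    Γ  : OrderedAbelianGroup g ℓΓ ℓ≤
  open Field K public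
  open OrderedAbelianGroup Γ public using () renaming (Carrier to ΓCarrier)
  field
    v        : Carrier → WithInfty ΓCarrier
    v-cong   : ∀ {x y} → x ≈ y → _≈∞_ Γ (v x) (v y)
    v-∞⇒0    : ∀ x → v x ≡ ∞ → x ≈ 0#
    v-0      : v 0# ≡ ∞
    v-mult   : ∀ x y → _≈∞_ Γ (v (x * y)) (_+∞_ Γ (v x) (v y))
    v-ultra  : ∀ x y → MinLe Γ (v x) (v y) (v (x + y))

module _ {c ℓ} (F : Field c ℓ) where
  open Field F

  ℕ→K : ℕ → Carrier
  ℕ→K zero    = 0#
  ℕ→K (suc n) = 1# + ℕ→K n

  pow : Carrier → ℕ → Carrier
  pow x zero    = 1#
  pow x (suc k) = x * pow x k

  ΣFin : (m : ℕ) → (Fin m → Carrier) → Carrier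
  ΣFin zero    g = 0#
  ΣFin (suc m) g = g fzero + ΣFin m (λ i → g (fsuc i))

  ΠFin : (m : ℕ) → (Fin m → Carrier) → Carrier
  ΠFin zero    g = 1#
  ΠFin (suc m) g = g fzero * ΠFin m (λ i → g (fsuc i))

  Exps : ℕ → Set
  Exps n = Fin n → ℕ

  cons : ∀ {n} → ℕ → Exps n → Exps (suc n)
  cons k e fzero    = k
  cons k e (fsuc i) = e i

  ΣExps : (n d : ℕ) → (Exps n → Carrier) → Carrier
  ΣExps zero    d g = g (λ ())
  ΣExps (suc n) d g = ΣFin (suc d) (λ j → ΣExps n d (λ e → g (cons (toℕ j) e)))

  record Poly (n : ℕ) : Set (c ⊔ ℓ) where
    field
      bound   : ℕ
      coeff   : Exps n → Carrier
      support : ∀ e (i : Fin n) → bound ℕ.< e i → coeff e ≈ 0#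
  open Poly public

  monomial : ∀ {n} → Exps n → (Fin n → Carrier) → Carrier
  monomial {n} e x = ΠFin n (λ i → pow (x i) (e i))

  eval : ∀ {n} → Poly n → (Fin n → Carrier) → Carrier
  eval {n} f x = ΣExps n (bound f) (λ e → coeff f e * monomial e x)

  δ0 : ℕ → Carrier
  δ0 zero    = 1#
  δ0 (suc _) = 0#

  δ : ∀ {n} → Exps n → Carrier
  δ {n} e = ΠFin n (λ i → δ0 (e i))

  _+ₑ_ : ∀ {n} → Exps n → Exps n → Exps n
  (a +ₑ b) i = a i ℕ.+ b i

  -- f is additive: f(X+Y) = f(X) + f(Y) as an identity in K[X,Y]
  -- (X, Y each n-tuples of variables).  Comparing the coefficients of
  -- X^a Y^b on both sides: on the left it is
  --   coeff(a+b) · Π_i binom(a_i+b_i, a_i),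
  -- on the right it is coeff(a)·[b = 0] + coeff(b)·[a = 0].
  IsAdditive : ∀ {n} → Poly n → Set ℓ
  IsAdditive {n} f =
    ∀ (a b : Exps n) →
      coeff f (a +ₑ b) * ΠFin n (λ i → ℕ→K ((a i ℕ.+ b i) C a i))
        ≈ coeff f a * δ b + coeff f b * δ a

  IsPPoly : ∀ {n} → Poly n → Set (c ⊔ ℓ)
  IsPPoly {n} h =
    Σ (Poly n) λ f → Σ Carrier λ k →
      IsAdditive f × (∀ e → coeff h e ≈ coeff f e + k * δ e)

  HasChar : ℕ → Set ℓ
  HasChar p = Prime p × (ℕ→K p ≈ 0#)

module _ {c ℓ g ℓΓ ℓ≤} (VK : ValuedField c ℓ g ℓΓ ℓ≤) where
  open ValuedField VK

  OptimalApprox : (Carrier → Set (c ⊔ ℓ)) → Set (c ⊔ ℓ ⊔ g ⊔ ℓ≤)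
  OptimalApprox S =
    ∀ z → Σ Carrier λ y → S y ×
      (∀ x → S x → _≤∞_ Γ (v (z - x)) (v (z - y)))

  Image : ∀ {n} → Poly K n → Carrier → Set (c ⊔ ℓ)
  Image {n} f z = Σ (Fin n → Carrier) λ x → eval K f x ≈ z

  Extremal : ∀ {n} → (Carrier → Set (c ⊔ ℓ)) → Poly K n → Set (c ⊔ ℓ ⊔ g ⊔ ℓ≤)
  Extremal {n} S h =
    Σ (Fin n → Carrier) λ x → (∀ i → S (x i)) ×
      (∀ (y : Fin n → Carrier) → (∀ i → S (y i)) →
        _≤∞_ Γ (v (eval K h y)) (v (eval K h x)))

  Whole : Carrier → Set (c ⊔ ℓ)
  Whole _ = Level.Lift (c ⊔ ℓ) Data.Unit.⊤
    where import Data.Unit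

module Submission where

-- The proof is a reformulation.  If h = f - c with f additive, then for
-- every point y we have  c - f(y) = -h(y)  and hence  v(c - f(y)) = v(h(y)).
-- So a best approximation f(x) of c by the image of f is exactly a point x
-- at which v∘h attains its maximum, and conversely.

open import Defs
open import Level using (Level; _⊔_; lift)
open import Data.Nat as ℕ using (ℕ; zero; suc; z≤n; s≤s)
open import Data.Nat.Properties using (≤-trans)
open import Data.Fin using (Fin; toℕ) renaming (zero to fzero; suc to fsuc)
open import Data.Product using (Σ; _×_; _,_)
open import Data.Sum using (inj₁; inj₂)
open import Data.Empty using (⊥-elim)
open import Relation.Nullary using (¬_)
open import Relation.Binary.PropositionalEquality as ≡ using (_≡_)
open import Relation.Binary.Structures using (IsTotalOrder)
import Algebra.Properties.Ring as RingProperties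
import Algebra.Properties.Group as GroupProperties
import Algebra.Properties.Monoid.Sum as MonoidSum
import Algebra.Properties.CommutativeMonoid.Sum as CommutativeMonoidSum
import Relation.Binary.Reasoning.Setoid as SetoidReasoning

-- Finite sums over the field.  ΣFin agrees with the library's sum over the
-- additive monoid, from which congruence and additivity are inherited; the
-- iterated sums ΣExps over multi-indices inherit them by induction.
module FiniteSums {c ℓ} (F : Field c ℓ) where
  open Field F
  open MonoidSum +-monoid using (sum; sum-cong-≋; sum-replicate-zero)
  open CommutativeMonoidSum +-commutativeMonoid using (∑-distrib-+)

  ΣFin≡sum : ∀ m g → ΣFin F m g ≡ sum g
  ΣFin≡sum zero    g = ≡.refl
  ΣFin≡sum (suc m) g = ≡.cong (g fzero +_) (ΣFin≡sum m (λ i → g (fsuc i)))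

  ΣFin-cong : ∀ m {g h} → (∀ i → g i ≈ h i) → ΣFin F m g ≈ ΣFin F m h
  ΣFin-cong m {g} {h} g≈h
    rewrite ΣFin≡sum m g | ΣFin≡sum m h = sum-cong-≋ g≈h

  ΣFin-0 : ∀ m {g} → (∀ i → g i ≈ 0#) → ΣFin F m g ≈ 0#
  ΣFin-0 m g≈0 = trans (ΣFin-cong m g≈0) sum-of-zeros
    where
    sum-of-zeros : ΣFin F m (λ _ → 0#) ≈ 0#
    sum-of-zeros rewrite ΣFin≡sum m (λ _ → 0#) = sum-replicate-zero m

  ΣFin-+ : ∀ m g h → ΣFin F m (λ i → g i + h i) ≈ ΣFin F m g + ΣFin F m h
  ΣFin-+ m g h
    rewrite ΣFin≡sum m (λ i → g i + h i) | ΣFin≡sum m g | ΣFin≡sum m h =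
    ∑-distrib-+ g h

  ΣExps-cong : ∀ n d {g h} → (∀ e → g e ≈ h e) → ΣExps F n d g ≈ ΣExps F n d h
  ΣExps-cong zero    d g≈h = g≈h _
  ΣExps-cong (suc n) d g≈h =
    ΣFin-cong (suc d) (λ j → ΣExps-cong n d (λ e → g≈h (cons F (toℕ j) e)))

  ΣExps-0 : ∀ n d {g} → (∀ e → g e ≈ 0#) → ΣExps F n d g ≈ 0#
  ΣExps-0 zero    d g≈0 = g≈0 _
  ΣExps-0 (suc n) d g≈0 =
    ΣFin-0 (suc d) (λ j → ΣExps-0 n d (λ e → g≈0 (cons F (toℕ j) e)))

  ΣExps-+ : ∀ n d g h →
    ΣExps F n d (λ e → g e + h e) ≈ ΣExps F n d g + ΣExps F n d h
  ΣExps-+ zero    d g h = refl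
  ΣExps-+ (suc n) d g h =
    trans (ΣFin-cong (suc d) (λ j → ΣExps-+ n d (slice g j) (slice h j)))
          (ΣFin-+ (suc d) (λ j → ΣExps F n d (slice g j))
                          (λ j → ΣExps F n d (slice h j)))
    where
    slice : (Exps F (suc n) → Carrier) → Fin (suc d) → Exps F n → Carrier
    slice u j e = u (cons F (toℕ j) e)

module ConstantShift {c ℓ} (F : Field c ℓ) where
  open Field F
  open FiniteSums F
  open SetoidReasoning setoid

  δ-nonzero : ∀ {n} (e : Exps F n) i → 0 ℕ.< e i → δ F e ≈ 0#
  δ-nonzero {suc n} e fzero    0<e₀ with e fzero
  ... | suc _ = zeroˡ _
  δ-nonzero {suc n} e (fsuc i) 0<eᵢ =
    trans (*-congˡ (δ-nonzero (λ j → e (fsuc j)) i 0<eᵢ)) (zeroʳ _)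

  ΣExps-constant : ∀ n d k (x : Fin n → Carrier) →
    ΣExps F n d (λ e → (k * δ F e) * monomial F e x) ≈ k
  ΣExps-constant zero    d k x = trans (*-identityʳ _) (*-identityʳ k)
  ΣExps-constant (suc n) d k x = begin
    ΣExps F n d (λ e → (k * (1# * δ F e)) * (1# * monomial F e x'))
      + ΣFin F d (λ j → ΣExps F n d (higher (suc (toℕ j))))
      ≈⟨ +-cong (trans (ΣExps-cong n d constant-term) (ΣExps-constant n d k x'))
                (ΣFin-0 d (λ j → ΣExps-0 n d (higher-vanishes (toℕ j)))) ⟩
    k + 0# ≈⟨ +-identityʳ k ⟩
    k ∎
    where
    x' : Fin n → Carrier
    x' i = x (fsuc i)
    constant-term : ∀ e → (k * (1# * δ F e)) * (1# * monomial F e x')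
                          ≈ (k * δ F e) * monomial F e x'
    constant-term e = *-cong (*-congˡ (*-identityˡ _)) (*-identityˡ _)
    higher : ℕ → Exps F n → Carrier
    higher j e = (k * δ F (cons F j e)) * monomial F (cons F j e) x
    higher-vanishes : ∀ j e → higher (suc j) e ≈ 0#
    higher-vanishes j e =
      trans (*-congʳ (trans (*-congˡ (zeroˡ _)) (zeroʳ k))) (zeroˡ _)

  ΣExps-shift : ∀ n d (ch cf : Exps F n → Carrier) k (x : Fin n → Carrier) →
    (∀ e → ch e ≈ cf e + k * δ F e) →
    ΣExps F n d (λ e → ch e * monomial F e x)
      ≈ ΣExps F n d (λ e → cf e * monomial F e x) + k
  ΣExps-shift n d ch cf k x h≈f+k = begin
    ΣExps F n d (λ e → ch e * monomial F e x)
      ≈⟨ ΣExps-cong n d (λ e → trans (*-congʳ (h≈f+k e)) (distribʳ _ _ _)) ⟩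
    ΣExps F n d (λ e → cf e * monomial F e x + (k * δ F e) * monomial F e x)
      ≈⟨ ΣExps-+ n d _ _ ⟩
    ΣExps F n d (λ e → cf e * monomial F e x)
      + ΣExps F n d (λ e → (k * δ F e) * monomial F e x)
      ≈⟨ +-congˡ (ΣExps-constant n d k x) ⟩
    ΣExps F n d (λ e → cf e * monomial F e x) + k ∎

  translate : ∀ {n} → Poly F n → Carrier → Poly F n
  translate f k = record
    { bound   = bound f
    ; coeff   = λ e → coeff f e + k * δ F e
    ; support = λ e i bound<eᵢ → trans
        (+-cong (support f e i bound<eᵢ)
                (trans (*-congˡ (δ-nonzero e i (≤-trans (s≤s z≤n) bound<eᵢ))) (zeroʳ k)))
        (+-identityʳ 0#) }

  eval-translate : ∀ {n} (f : Poly F n) k x →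
    eval F (translate f k) x ≈ eval F f x + k
  eval-translate {n} f k x = ΣExps-shift n (bound f) _ (coeff f) k x (λ _ → refl)

  -- If h = f + k coefficientwise, then f vanishes beyond the bound of h, so
  -- f may be re-presented with the bound of h.
  restrict : ∀ {n} (h f : Poly F n) k → (∀ e → coeff h e ≈ coeff f e + k * δ F e) →
    Poly F n
  restrict h f k h≈f+k = record
    { bound   = bound h
    ; coeff   = coeff f
    ; support = λ e i bound<eᵢ → begin
        coeff f e            ≈⟨ sym (+-identityʳ _) ⟩
        coeff f e + 0#       ≈⟨ +-congˡ (sym (trans (*-congˡ
                                  (δ-nonzero e i (≤-trans (s≤s z≤n) bound<eᵢ))) (zeroʳ k))) ⟩
        coeff f e + k * δ F e ≈⟨ sym (h≈f+k e) ⟩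
        coeff h e            ≈⟨ support h e i bound<eᵢ ⟩
        0#                   ∎ }

  eval-restrict : ∀ {n} (h f : Poly F n) k h≈f+k x →
    eval F h x ≈ eval F (restrict h f k h≈f+k) x + k
  eval-restrict {n} h f k h≈f+k x = ΣExps-shift n (bound h) (coeff h) (coeff f) k x h≈f+k

module Valuation {c ℓ g ℓΓ ℓ≤} (VK : ValuedField c ℓ g ℓΓ ℓ≤) where
  open ValuedField VK
  module G = OrderedAbelianGroup Γ
  module Order = IsTotalOrder G.isTotalOrder
  open RingProperties ring using (-1*x≈-x; -‿involutive)
  open GroupProperties G.group using (identityˡ-unique)

  _≃_ : WithInfty ΓCarrier → WithInfty ΓCarrier → Set (g ⊔ ℓΓ)
  _≃_ = _≈∞_ Γ
  _≼_ : WithInfty ΓCarrier → WithInfty ΓCarrier → Set (g ⊔ ℓ≤)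
  _≼_ = _≤∞_ Γ

  ≃-sym : ∀ {x y} → x ≃ y → y ≃ x
  ≃-sym (ι≈ι a≈b) = ι≈ι (G.sym a≈b)
  ≃-sym ∞≈∞       = ∞≈∞

  ≃-trans : ∀ {x y z} → x ≃ y → y ≃ z → x ≃ z
  ≃-trans (ι≈ι a≈b) (ι≈ι b≈c) = ι≈ι (G.trans a≈b b≈c)
  ≃-trans ∞≈∞       ∞≈∞       = ∞≈∞

  ι-injective : ∀ {a b} → ι a ≃ ι b → a G.≈ b
  ι-injective (ι≈ι a≈b) = a≈b

  ≼-resp-≃ : ∀ {x x' y y'} → x ≃ x' → y ≃ y' → x ≼ y → x' ≼ y'
  ≼-resp-≃ (ι≈ι a≈a') (ι≈ι b≈b') (ι≤ι a≤b) =
    ι≤ι (Order.≤-respʳ-≈ b≈b' (Order.≤-respˡ-≈ a≈a' a≤b))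
  ≼-resp-≃ _ ∞≈∞ _ = _ ≤∞

  double-zero : ∀ γ → γ G.+ γ G.≈ G.0g → γ G.≈ G.0g
  double-zero γ 2γ≈0 with Order.total γ G.0g
  ... | inj₁ γ≤0 = Order.antisym γ≤0
          (Order.≤-respʳ-≈ (G.identityˡ γ) (Order.≤-respˡ-≈ 2γ≈0 (G.+-mono-≤ γ G.0g γ γ≤0)))
  ... | inj₂ 0≤γ = Order.antisym
          (Order.≤-respʳ-≈ 2γ≈0 (Order.≤-respˡ-≈ (G.identityˡ γ) (G.+-mono-≤ G.0g γ γ 0≤γ))) 0≤γ

  v-square : ∀ x → ¬ x ≈ 0# → Σ ΓCarrier λ γ → (v x ≃ ι γ) × (v (x * x) ≃ ι (γ G.+ γ))
  v-square x x≉0 with v x in vx≡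
  ... | ∞   = ⊥-elim (x≉0 (v-∞⇒0 x vx≡))
  ... | ι γ = γ , ι≈ι G.refl , value-of-square
    where
    double : ∀ {w} → w ≡ ι γ → _+∞_ Γ w w ≃ ι (γ G.+ γ)
    double ≡.refl = ι≈ι G.refl
    value-of-square : v (x * x) ≃ ι (γ G.+ γ)
    value-of-square = ≃-trans (v-mult x x) (double vx≡)

  -- v(1) = 0, since v(1) = v(1) + v(1).
  v-1 : v 1# ≃ ι G.0g
  v-1 with v-square 1# 1≉0
  ... | β , v1≃β , v1·1≃2β = ≃-trans v1≃β (ι≈ι (identityˡ-unique β β (G.sym β≈2β)))
    where
    β≈2β : β G.≈ β G.+ β
    β≈2β = ι-injective (≃-trans (≃-sym v1≃β) (≃-trans (v-cong (sym (*-identityˡ 1#))) v1·1≃2β))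

  root-of-1≉0 : ∀ x → x * x ≈ 1# → ¬ x ≈ 0#
  root-of-1≉0 x x²≈1 x≈0 = 1≉0 (trans (sym x²≈1) (trans (*-congʳ x≈0) (zeroˡ x)))

  v-root-of-1 : ∀ x → x * x ≈ 1# → v x ≃ ι G.0g
  v-root-of-1 x x²≈1 with v-square x (root-of-1≉0 x x²≈1)
  ... | γ , vx≃γ , vx²≃2γ =
    ≃-trans vx≃γ (ι≈ι (double-zero γ (ι-injective
      (≃-trans (≃-sym vx²≃2γ) (≃-trans (v-cong x²≈1) v-1)))))

  -- v(-a) = v(-1) + v(a) = v(a).
  v-neg : ∀ a → v (- a) ≃ v a
  v-neg a = ≃-trans (v-cong (sym (-1*x≈-x a)))
           (≃-trans (v-mult (- 1#) a) (add-zero (v a) (v-root-of-1 (- 1#) -1²≈1)))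
    where
    -1²≈1 : - 1# * - 1# ≈ 1#
    -1²≈1 = trans (-1*x≈-x (- 1#)) (-‿involutive 1#)
    add-zero : ∀ {x} y → x ≃ ι G.0g → _+∞_ Γ x y ≃ y
    add-zero (ι b) (ι≈ι a≈0) = ι≈ι (G.trans (G.∙-congʳ a≈0) (G.identityˡ b))
    add-zero ∞     (ι≈ι _)   = ∞≈∞

module Approximation {c ℓ g ℓΓ ℓ≤} (VK : ValuedField c ℓ g ℓΓ ℓ≤) where
  open ValuedField VK
  open Valuation VK
  open RingProperties ring using (⁻¹-anti-homo‿-)

  -- a best approximation of z by elements of S; OptimalApprox VK S unfolds
  -- to ∀ z → BestApprox S z
  BestApprox : (Carrier → Set (c ⊔ ℓ)) → Carrier → Set (c ⊔ ℓ ⊔ g ⊔ ℓ≤)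
  BestApprox S z = Σ Carrier λ y → S y × (∀ x → S x → v (z - x) ≼ v (z - y))

  module _ {n} (f h : Poly K n) (t : Carrier)
           (h≈f-t : ∀ y → eval K h y ≈ eval K f y - t) where

    -- t - f(y) = -h(y), so the distance from t to f(y) is measured by v∘h
    distance≃v∘h : ∀ y → v (t - eval K f y) ≃ v (eval K h y)
    distance≃v∘h y = ≃-trans
      (v-cong (trans (sym (⁻¹-anti-homo‿- (eval K f y) t)) (-‿cong (sym (h≈f-t y)))))
      (v-neg (eval K h y))

    best⇒extremal : BestApprox (Image VK f) t → Extremal VK (Whole VK) h
    best⇒extremal (_ , (x , fx≈y₀) , best) = x , (λ _ → lift _) , maximal
      where
      maximal : ∀ y → (∀ i → Whole VK (y i)) → v (eval K h y) ≼ v (eval K h x)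
      maximal y _ = ≼-resp-≃ (distance≃v∘h y)
        (≃-trans (v-cong (+-congˡ (-‿cong (sym fx≈y₀)))) (distance≃v∘h x))
        (best (eval K f y) (y , refl))

    extremal⇒best : Extremal VK (Whole VK) h → BestApprox (Image VK f) t
    extremal⇒best (x , _ , maximal) = eval K f x , (x , refl) , best
      where
      best : ∀ z → Image VK f z → v (t - z) ≼ v (t - eval K f x)
      best z (y , fy≈z) = ≼-resp-≃
        (≃-trans (≃-sym (distance≃v∘h y)) (v-cong (+-congˡ (-‿cong fy≈z))))
        (≃-sym (distance≃v∘h x))
        (maximal y (λ _ → lift _))

module _ {c ℓ g ℓΓ ℓ≤} (VK : ValuedField c ℓ g ℓΓ ℓ≤) where
  open ValuedField VK
  open ConstantShift K
  open Approximation VK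
  open RingProperties ring using (-‿involutive)

  AdditiveImagesOptimal : Set (c ⊔ ℓ ⊔ g ⊔ ℓ≤)
  AdditiveImagesOptimal =
    ∀ (n : ℕ) (f : Poly K n) → IsAdditive K f → OptimalApprox VK (Image VK f)

  ExtremalForPPolynomials : Set (c ⊔ ℓ ⊔ g ⊔ ℓ≤)
  ExtremalForPPolynomials =
    ∀ (n : ℕ) (h : Poly K n) → IsPPoly K h → Extremal VK (Whole VK) h

  -- For h = f + k, a best approximation of -k by Im f is a maximum of v∘h.
  optimal⇒extremal : AdditiveImagesOptimal → ExtremalForPPolynomials
  optimal⇒extremal optimal n h (f , k , f-additive , h≈f+k) =
    best⇒extremal f' h (- k) h≈f'+k (optimal n f' f-additive (- k))
    where
    f' : Poly K n
    f' = restrict h f k h≈f+k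
    h≈f'+k : ∀ y → eval K h y ≈ eval K f' y - (- k)
    h≈f'+k y = trans (eval-restrict h f k h≈f+k y) (+-congˡ (sym (-‿involutive k)))

  -- To approximate z by Im f, maximise v∘(f - z).
  extremal⇒optimal : ExtremalForPPolynomials → AdditiveImagesOptimal
  extremal⇒optimal extremal n f f-additive z =
    extremal⇒best f (translate f (- z)) z (eval-translate f (- z))
      (extremal n (translate f (- z)) (f , - z , f-additive , λ _ → refl))

lemma3p1 : ∀ {c ℓ g ℓΓ ℓ≤ : Level} (VK : ValuedField c ℓ g ℓΓ ℓ≤) (p : ℕ) →
    HasChar (ValuedField.K VK) p →
    ((∀ (n : ℕ) (f : Poly (ValuedField.K VK) n) → IsAdditive (ValuedField.K VK) f →
    OptimalApprox VK (Image VK f))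
    → (∀ (n : ℕ) (h : Poly (ValuedField.K VK) n) → IsPPoly (ValuedField.K VK) h →
    Extremal VK (Whole VK) h))
    × ((∀ (n : ℕ) (h : Poly (ValuedField.K VK) n) → IsPPoly (ValuedField.K VK) h →
    Extremal VK (Whole VK) h)
    → (∀ (n : ℕ) (f : Poly (ValuedField.K VK) n) → IsAdditive (ValuedField.K VK) f →
    OptimalApprox VK (Image VK f)))
lemma3p1 VK _ _ = optimal⇒extremal VK , extremal⇒optimal VK
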